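{- If a connected noncomplete graph $G$ has two edge-disjoint odd cycles, then $\mathit{pW}(G)=2$.
   Context: All graphs are finite and simple. An edge-coloring of $G$ is any assignment of colors to the edges (not necessarily proper). A walk is properly colored if no two consecutive edges have the same color. For a connected graph $G$, $\mathit{pW}(G)$ is the minimum number of colors in an edge-coloring of $G$ such that between every pair of vertices there is a properly colored walk. -}

module Defs where

open import Data.Nat using (ℕ; zero; suc; _≤_)
open import Data.Nat.Properties using ()
open import Data.Fin using (Fin; zero; suc; inject₁; fromℕ)
open import Data.Unit using (⊤; tt)
open import Data.Bool using (Bool; true; false)
open import Data.Product using (Σ; ∃; ∃-syntax; _×_; _,_)
open import Data.Sum using (_⊎_)
open import Function.Definitions using (Injective)
open import Relation.Binary.PropositionalEquality using (_≡_; _≢_)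
open import Relation.Nullary using (¬_)

record Graph (n : ℕ) : Set where
  field
    adj     : Fin n → Fin n → Bool
    symm    : ∀ u v → adj u v ≡ adj v u
    irrefl  : ∀ u → adj u u ≡ false

open Graph public

Adj : ∀ {n} → Graph n → Fin n → Fin n → Set
Adj G u v = adj G u v ≡ true

data Walk {n} (G : Graph n) : Fin n → Fin n → Set where
  [_]  : (u : Fin n) → Walk G u u
  cons : (u : Fin n) {v w : Fin n} → Adj G u v → Walk G v w → Walk G u w

Connected : ∀ {n} → Graph n → Set
Connected {n} G = ∀ (u v : Fin n) → Walk G u v

NonComplete : ∀ {n} → Graph n → Set
NonComplete {n} G = Σ (Fin n) λ u → Σ (Fin n) λ v → u ≢ v × adj G u v ≡ false

-- An edge-coloring with k colours: a colour for every (unordered) pair,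
-- i.e. a symmetric function; values on non-edges are irrelevant.
record EdgeColoring {n} (G : Graph n) (k : ℕ) : Set where
  field
    col      : Fin n → Fin n → Fin k
    col-symm : ∀ u v → col u v ≡ col v u

open EdgeColoring public

ProperlyColored : ∀ {n k} {G : Graph n} (c : EdgeColoring G k) {u v : Fin n} → Walk G u v → Set
ProperlyColored c [ u ] = ⊤
ProperlyColored c (cons u _ [ v ]) = ⊤
ProperlyColored c (cons u _ (cons v {w} e W)) =
  (col c u v ≢ col c v w) × ProperlyColored c (cons v e W)

PWColoring : ∀ {n k} (G : Graph n) → EdgeColoring G k → Set
PWColoring {n} G c = ∀ (u v : Fin n) → Σ (Walk G u v) (ProperlyColored c)

pW≡ : ∀ {n} → Graph n → ℕ → Set
pW≡ G k =
  Σ (EdgeColoring G k) (PWColoring G)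
  × (∀ j → suc j ≤ k → ¬ Σ (EdgeColoring G j) (PWColoring G))

record Cycle {n} (G : Graph n) : Set where
  field
    m      : ℕ
    len≥3  : 3 ≤ suc m
    vtx    : Fin (suc m) → Fin n
    inj    : Injective _≡_ _≡_ vtx
    step   : ∀ (i : Fin m) → Adj G (vtx (inject₁ i)) (vtx (suc i))
    close  : Adj G (vtx (fromℕ m)) (vtx zero)

open Cycle public

data Odd : ℕ → Set where
  odd1  : Odd 1
  odd+2 : ∀ {k} → Odd k → Odd (suc (suc k))

OddCycle : ∀ {n} {G : Graph n} → Cycle G → Set
OddCycle C = Odd (suc (m C))

SamePair : ∀ {n} → Fin n → Fin n → Fin n → Fin n → Set
SamePair x y a b = (x ≡ a × y ≡ b) ⊎ (x ≡ b × y ≡ a)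

CycleEdge : ∀ {n} {G : Graph n} → Cycle G → Fin n → Fin n → Set
CycleEdge C x y =
  (Σ (Fin (m C)) λ i → SamePair x y (vtx C (inject₁ i)) (vtx C (suc i)))
  ⊎ SamePair x y (vtx C (fromℕ (m C))) (vtx C zero)

EdgeDisjoint : ∀ {n} {G : Graph n} → Cycle G → Cycle G → Set
EdgeDisjoint {n} C D = ∀ (x y : Fin n) → CycleEdge C x y → ¬ CycleEdge D x y

-- With two colors a properly colored walk is an alternating one. Suppose every vertex has
-- an alternating walk to a hub c₀, and c₀ carries alternating closed walks whose first and
-- last edges both have color 0, resp. both color 1. Then walks u → c₀ and v → c₀ glue to a
-- walk u → v, through one of the closed walks when they arrive with the same color.
-- To get such a coloring take distances to the odd cycle C, a vertex d₀ of D closest to C,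
-- and c₀ the end of a shortest path from d₀ to C. Color the edges of D alternately from d₀,
-- the remaining edges inside C alternately from c₀ (no edge of C is an edge of D), and every
-- other edge by the parity of the larger distance of its ends; the path then alternates, and
-- by the choice of d₀ it meets D only in d₀. On an alternately colored odd cycle the two
-- edges at the start get the same color, so C is a closed walk at c₀ of type (0,0), and the
-- path, once around D and back, one of type (1,1). Vertices of C and D reach c₀ around their
-- cycle, all others down the distance tree. One color cannot suffice, since then only single
-- edges are alternating and G has a non-adjacent pair.

module Submission where

open import Defs
open import Data.Bool using (true; if_then_else_) renaming (_≟_ to _≟ᵇ_)
open import Data.Empty using (⊥-elim)
open import Data.Fin using (Fin; zero; suc; toℕ; inject₁; fromℕ; fromℕ<) renaming (_≟_ to _≟ᶠ_)
open import Data.Fin.Properties using (any?; toℕ-injective; toℕ<n; toℕ-fromℕ<; toℕ-inject₁; toℕ-fromℕ)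
open import Data.List using (allFin)
open import Data.List.Extrema.Nat using (argmin; f[argmin]≤f[xs])
open import Data.List.Membership.Propositional.Properties using (∈-allFin)
open import Data.List.Relation.Unary.All using (lookup)
open import Data.Maybe using (Maybe; just; nothing; zipWith; fromMaybe; _<∣>_)
open import Data.Nat
  using (ℕ; zero; suc; _+_; _∸_; _≤_; _<_; _≤′_; ≤′-refl; ≤′-step; _⊓_; _⊔_; _%_; NonZero; z≤n; s≤s; parity)
open import Data.Nat.DivMod using (_mod_; %-distribˡ-+; m%n%n≡m%n; [m+n]%n≡m%n; m<n⇒m%n≡m; n%n≡0; m%n<n)
open import Data.Nat.GeneralisedArithmetic using (iterate)
open import Data.Nat.Properties
  using (+-assoc; +-comm; m∸n+n≡m; m+[n∸m]≡n; <⇒≤; ≤-pred; ≤-refl; ≤-reflexive; ≤-trans; ≤-antisym;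
         <-≤-trans; ≮⇒≥; 1+n≰n; n≤1+n; 0≢1+n; suc-injective; ≤⇒≤′; m<n⇒m<1+n; m≤n⇒m<n∨m≡n;
         m≤n⇒m⊓n≡m; ⊓-zeroʳ; ⊓-comm; ⊔-comm; m≥n⇒m⊔n≡m)
open import Data.Parity using (Parity; 0ℙ; 1ℙ; _⁻¹) renaming (_+_ to _+ᵖ_)
open import Data.Parity.Properties using (⁻¹-involutive; p≢p⁻¹; +-homo-+; suc-homo-⁻¹)
open import Data.Product using (Σ; ∃; _×_; _,_; proj₁; proj₂)
open import Data.Sum using (_⊎_; inj₁; inj₂)
open import Data.Unit using (tt)
open import Function using (_∘_; mk⇔)
open import Level using (0ℓ)
open import Relation.Binary.PropositionalEquality
open import Relation.Nullary using (Dec; ¬_; yes; no; does; _×-dec_; _⊎-dec_)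
open import Relation.Nullary.Decidable using (dec-true; dec-false; does-⇔)
open import Relation.Unary using (Pred; Decidable)

parity-suc : ∀ n → parity (suc n) ≡ parity n ⁻¹
parity-suc zero          = refl
parity-suc (suc zero)    = refl
parity-suc (suc (suc n)) = parity-suc n

parity[m+o]≡parity[o] : ∀ m o → parity m ≡ 0ℙ → parity (m + o) ≡ parity o
parity[m+o]≡parity[o] m o m-even = trans (+-homo-+ m o) (cong (_+ᵖ parity o) m-even)

Odd[1+k]⇒parity[k]≡0ℙ : ∀ {k} → Odd (suc k) → parity k ≡ 0ℙ
Odd[1+k]⇒parity[k]≡0ℙ odd1                 = refl
Odd[1+k]⇒parity[k]≡0ℙ (odd+2 {suc k} odd) = Odd[1+k]⇒parity[k]≡0ℙ odd

p≡q⊎p≡q⁻¹ : ∀ p q → p ≡ q ⊎ p ≡ q ⁻¹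
p≡q⊎p≡q⁻¹ 0ℙ 0ℙ = inj₁ refl
p≡q⊎p≡q⁻¹ 0ℙ 1ℙ = inj₂ refl
p≡q⊎p≡q⁻¹ 1ℙ 0ℙ = inj₂ refl
p≡q⊎p≡q⁻¹ 1ℙ 1ℙ = inj₁ refl

toFin2 : Parity → Fin 2
toFin2 0ℙ = zero
toFin2 1ℙ = suc zero

toFin2-injective : ∀ {p q} → toFin2 p ≡ toFin2 q → p ≡ q
toFin2-injective {0ℙ} {0ℙ} _ = refl
toFin2-injective {1ℙ} {1ℙ} _ = refl

zipWith-comm : ∀ {A B : Set} {f : A → A → B} → (∀ a b → f a b ≡ f b a) →
               ∀ ma mb → zipWith f ma mb ≡ zipWith f mb ma
zipWith-comm f-comm (just a) (just b) = cong just (f-comm a b)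
zipWith-comm f-comm (just _) nothing  = refl
zipWith-comm f-comm nothing  (just _) = refl
zipWith-comm f-comm nothing  nothing  = refl

[m%n+k]%n≡[m+k]%n : ∀ m k n .{{_ : NonZero n}} → (m % n + k) % n ≡ (m + k) % n
[m%n+k]%n≡[m+k]%n m k n = begin
  (m % n + k) % n         ≡⟨ %-distribˡ-+ (m % n) k n ⟩
  (m % n % n + k % n) % n ≡⟨ cong (λ a → (a + k % n) % n) (m%n%n≡m%n m n) ⟩
  (m % n + k % n) % n     ≡⟨ %-distribˡ-+ m k n ⟨
  (m + k) % n             ∎
  where open ≡-Reasoning

[[m+j]%n+k]%n≡m%n : ∀ m j k n .{{_ : NonZero n}} → j + k ≡ n → ((m + j) % n + k) % n ≡ m % n
[[m+j]%n+k]%n≡m%n m j k n j+k≡n = begin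
  ((m + j) % n + k) % n ≡⟨ [m%n+k]%n≡[m+k]%n (m + j) k n ⟩
  (m + j + k) % n       ≡⟨ cong (_% n) (trans (+-assoc m j k) (cong (m +_) j+k≡n)) ⟩
  (m + n) % n           ≡⟨ [m+n]%n≡m%n m n ⟩
  m % n                 ∎
  where open ≡-Reasoning

Adj-sym : ∀ {n} (G : Graph n) {x y} → Adj G x y → Adj G y x
Adj-sym G {x} {y} e = trans (symm G y x) e

SamePair-comm : ∀ {n} {x y a b : Fin n} → SamePair x y a b → SamePair y x a b
SamePair-comm (inj₁ (x≡a , y≡b)) = inj₂ (y≡b , x≡a)
SamePair-comm (inj₂ (x≡b , y≡a)) = inj₁ (y≡a , x≡b)

samePair? : ∀ {n} (x y a b : Fin n) → Dec (SamePair x y a b)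
samePair? x y a b = (x ≟ᶠ a ×-dec y ≟ᶠ b) ⊎-dec (x ≟ᶠ b ×-dec y ≟ᶠ a)

module CycleWalk {n} {G : Graph n} (C : Cycle G) where

  N : ℕ
  N = suc (m C)

  CycleEdge-comm : ∀ {x y} → CycleEdge C x y → CycleEdge C y x
  CycleEdge-comm (inj₁ (i , p)) = inj₁ (i , SamePair-comm p)
  CycleEdge-comm (inj₂ p)       = inj₂ (SamePair-comm p)

  cycleEdge? : ∀ x y → Dec (CycleEdge C x y)
  cycleEdge? x y = any? (λ i → samePair? x y (vtx C (inject₁ i)) (vtx C (suc i)))
                   ⊎-dec samePair? x y (vtx C (fromℕ (m C))) (vtx C zero)

  CycleEdge⇒Adj : ∀ {x y} → CycleEdge C x y → Adj G x y
  CycleEdge⇒Adj (inj₁ (i , inj₁ (refl , refl))) = step C i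
  CycleEdge⇒Adj (inj₁ (i , inj₂ (refl , refl))) = Adj-sym G (step C i)
  CycleEdge⇒Adj (inj₂ (inj₁ (refl , refl)))     = close C
  CycleEdge⇒Adj (inj₂ (inj₂ (refl , refl)))     = Adj-sym G (close C)

  OnCycle : Fin n → Set
  OnCycle x = ∃ λ f → vtx C f ≡ x

  onCycle? : ∀ x → Dec (OnCycle x)
  onCycle? x = any? (λ f → vtx C f ≟ᶠ x)

  CycleEdge⇒OnCycle : ∀ {x y} → CycleEdge C x y → OnCycle x × OnCycle y
  CycleEdge⇒OnCycle (inj₁ (i , inj₁ (refl , refl))) = (inject₁ i , refl) , (suc i , refl)
  CycleEdge⇒OnCycle (inj₁ (i , inj₂ (refl , refl))) = (suc i , refl) , (inject₁ i , refl)
  CycleEdge⇒OnCycle (inj₂ (inj₁ (refl , refl)))     = (fromℕ (m C) , refl) , (zero , refl)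
  CycleEdge⇒OnCycle (inj₂ (inj₂ (refl , refl)))     = (zero , refl) , (fromℕ (m C) , refl)

  cyc : ℕ → Fin n
  cyc i = vtx C (i mod N)

  cyc-vtx : ∀ i {f} → i % N ≡ toℕ f → cyc i ≡ vtx C f
  cyc-vtx i eq = cong (vtx C) (toℕ-injective (trans (toℕ-fromℕ< (m%n<n i N)) eq))

  cyc-cong : ∀ i j → i % N ≡ j % N → cyc i ≡ cyc j
  cyc-cong i j eq = cyc-vtx i (trans eq (sym (toℕ-fromℕ< (m%n<n j N))))

  [1+i]%N≡[1+i%N]%N : ∀ i → suc i % N ≡ suc (i % N) % N
  [1+i]%N≡[1+i%N]%N i = begin
    (1 + i) % N     ≡⟨ cong (_% N) (+-comm 1 i) ⟩
    (i + 1) % N     ≡⟨ [m%n+k]%n≡[m+k]%n i 1 N ⟨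
    (i % N + 1) % N ≡⟨ cong (_% N) (+-comm (i % N) 1) ⟩
    suc (i % N) % N ∎
    where open ≡-Reasoning

  [1+i]%N≡1+i%N : ∀ {i} → i % N < m C → suc i % N ≡ suc (i % N)
  [1+i]%N≡1+i%N {i} r<m = trans ([1+i]%N≡[1+i%N]%N i) (m<n⇒m%n≡m (s≤s r<m))

  [1+i]%N≡0 : ∀ {i} → i % N ≡ m C → suc i % N ≡ 0
  [1+i]%N≡0 {i} r≡m = trans ([1+i]%N≡[1+i%N]%N i) (trans (cong (λ r → suc r % N) r≡m) (n%n≡0 N))

  cyc-edge : ∀ i → CycleEdge C (cyc i) (cyc (suc i))
  cyc-edge i with m≤n⇒m<n∨m≡n (≤-pred (m%n<n i N))
  ... | inj₁ r<m = inj₁ (fromℕ< r<m , inj₁ (cyc-vtx i (sym (trans (toℕ-inject₁ (fromℕ< r<m)) toℕ-j)) ,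
                                            cyc-vtx (suc i) (trans ([1+i]%N≡1+i%N r<m) (cong suc (sym toℕ-j)))))
    where toℕ-j = toℕ-fromℕ< r<m
  ... | inj₂ r≡m = inj₂ (inj₁ (cyc-vtx i (trans r≡m (sym (toℕ-fromℕ (m C)))) , cyc-vtx (suc i) ([1+i]%N≡0 r≡m)))

  module Rotation (k : Fin N) where

    s : ℕ → Fin n
    s i = cyc (i + toℕ k)

    k≤N : toℕ k ≤ N
    k≤N = <⇒≤ (toℕ<n k)

    s-0 : s 0 ≡ vtx C k
    s-0 = cyc-vtx (toℕ k) (m<n⇒m%n≡m (toℕ<n k))

    s-N : s N ≡ s 0
    s-N = cyc-cong (N + toℕ k) (toℕ k) (trans (cong (_% N) (+-comm N (toℕ k))) ([m+n]%n≡m%n (toℕ k) N))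

    s-edge : ∀ i → CycleEdge C (s i) (s (suc i))
    s-edge i = cyc-edge (i + toℕ k)

    position : Fin n → Maybe ℕ
    position x with onCycle? x
    ... | yes (f , _) = just ((toℕ f + (N ∸ toℕ k)) % N)
    ... | no _        = nothing

    position-just : ∀ {x i} → position x ≡ just i → i < N × s i ≡ x
    position-just {x} eq with onCycle? x
    position-just refl | yes (f , refl) = m%n<n (toℕ f + (N ∸ toℕ k)) N , cyc-vtx (i + toℕ k) i+k≡f
      where
        i = (toℕ f + (N ∸ toℕ k)) % N
        i+k≡f : (i + toℕ k) % N ≡ toℕ f
        i+k≡f = trans ([[m+j]%n+k]%n≡m%n (toℕ f) (N ∸ toℕ k) (toℕ k) N (m∸n+n≡m k≤N)) (m<n⇒m%n≡m (toℕ<n f))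

    position-s : ∀ {i} → i < N → position (s i) ≡ just i
    position-s {i} i<N with onCycle? (s i)
    ... | no ¬on = ⊥-elim (¬on (_ , refl))
    ... | yes (f , vf≡si) = cong just (begin
      (toℕ f + (N ∸ toℕ k)) % N           ≡⟨ cong (λ a → (a + (N ∸ toℕ k)) % N) f≡ ⟩
      ((i + toℕ k) % N + (N ∸ toℕ k)) % N ≡⟨ [[m+j]%n+k]%n≡m%n i (toℕ k) (N ∸ toℕ k) N (m+[n∸m]≡n k≤N) ⟩
      i % N                               ≡⟨ m<n⇒m%n≡m i<N ⟩
      i                                   ∎)
      where
        open ≡-Reasoning
        f≡ : toℕ f ≡ (i + toℕ k) % N
        f≡ = trans (cong toℕ (inj C vf≡si)) (toℕ-fromℕ< (m%n<n (i + toℕ k) N))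

    position-nothing : ∀ {x} → ¬ OnCycle x → position x ≡ nothing
    position-nothing {x} ¬on with onCycle? x
    ... | yes on = ⊥-elim (¬on on)
    ... | no _   = refl

    OnCycle⇒position : ∀ {x} → OnCycle x → ∃ λ i → position x ≡ just i
    OnCycle⇒position {x} on with onCycle? x
    ... | yes _  = _ , refl
    ... | no ¬on = ⊥-elim (¬on on)

    alternatingColor : ℕ → Fin n → Fin n → Maybe Parity
    alternatingColor o x y = zipWith (λ i j → parity (i ⊓ j + o)) (position x) (position y)

    alternatingColor-comm : ∀ o x y → alternatingColor o x y ≡ alternatingColor o y x
    alternatingColor-comm o x y =
      zipWith-comm (λ i j → cong (λ a → parity (a + o)) (⊓-comm i j)) (position x) (position y)

    alternatingColor-nothing : ∀ o {x} y → ¬ OnCycle x → alternatingColor o x y ≡ nothing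
    alternatingColor-nothing o y ¬on rewrite position-nothing ¬on = refl

    -- The closing edge gets the color of position min(m, 0) = 0, which is right because m is even.
    alternatingColor-step : parity (m C) ≡ 0ℙ → ∀ o {i} → i < N →
                            alternatingColor o (s i) (s (suc i)) ≡ just (parity (i + o))
    alternatingColor-step m-even o {i} i<N with m≤n⇒m<n∨m≡n i<N
    ... | inj₁ 1+i<N rewrite position-s i<N | position-s 1+i<N =
      cong (λ a → just (parity (a + o))) (m≤n⇒m⊓n≡m (n≤1+n i))
    ... | inj₂ 1+i≡N rewrite position-s i<N | cong s 1+i≡N | s-N | position-s {0} (s≤s z≤n) =
      cong just (trans (cong (λ a → parity (a + o)) (⊓-zeroʳ i)) (sym (parity[m+o]≡parity[o] i o i-even)))
      where
        i-even : parity i ≡ 0ℙ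
        i-even = subst (λ j → parity j ≡ 0ℙ) (sym (suc-injective 1+i≡N)) m-even

least : ∀ {P : Pred ℕ 0ℓ} → Decidable P → ∀ {B} → P B →
        ∃ λ k → P k × (∀ {j} → j < k → ¬ P j)
least P? {zero} p = 0 , p , λ ()
least P? {suc B} p with P? 0
... | yes p₀ = 0 , p₀ , λ ()
... | no ¬p₀ with least (P? ∘ suc) p
...   | k , pk , below = suc k , pk , λ { {zero} _ → ¬p₀ ; {suc j} (s≤s j<k) → below j<k }

length : ∀ {n} {G : Graph n} {x y} → Walk G x y → ℕ
length [ _ ]        = zero
length (cons _ _ w) = suc (length w)

module Distance {n} (G : Graph n) (conn : Connected G) {S : Pred (Fin n) 0ℓ} (S? : Decidable S)
                {s₀} (S-s₀ : S s₀) where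

  Within : ℕ → Fin n → Set
  Within zero    x = S x
  Within (suc k) x = Within k x ⊎ ∃ λ y → Adj G x y × Within k y

  within? : ∀ k → Decidable (Within k)
  within? zero      = S?
  within? (suc k) x = within? k x ⊎-dec any? (λ y → (adj G x y ≟ᵇ true) ×-dec within? k y)

  within-length : ∀ {x} (w : Walk G x s₀) → Within (length w) x
  within-length [ _ ]        = S-s₀
  within-length (cons _ e w) = inj₂ (_ , e , within-length w)

  private
    search : ∀ x → ∃ λ k → Within k x × (∀ {j} → j < k → ¬ Within j x)
    search x = least (λ k → within? k x) {length (conn x s₀)} (within-length (conn x s₀))

  -- Opaque: letting unification unfold the search makes type checking prohibitively slow.
  opaque
    dist : Fin n → ℕ
    dist x = proj₁ (search x)

    within-dist : ∀ x → Within (dist x) x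
    within-dist x = proj₁ (proj₂ (search x))

    dist-≤ : ∀ {k x} → Within k x → dist x ≤ k
    dist-≤ {k} {x} w = ≮⇒≥ (λ k<d → proj₂ (proj₂ (search x)) k<d w)

  dist≡0⇒S : ∀ {x} → dist x ≡ 0 → S x
  dist≡0⇒S {x} d≡0 = subst (λ k → Within k x) d≡0 (within-dist x)

  S⇒dist≡0 : ∀ {x} → S x → dist x ≡ 0
  S⇒dist≡0 Sx = ≤-antisym (dist-≤ Sx) z≤n

  descend : ∀ {x k} → dist x ≡ suc k → ∃ λ y → Adj G x y × dist y ≡ k
  descend {x} {k} d≡1+k with subst (λ j → Within j x) d≡1+k (within-dist x)
  ... | inj₁ within-k = ⊥-elim (1+n≰n (subst (_≤ k) d≡1+k (dist-≤ within-k)))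
  ... | inj₂ (y , e , within-y) = y , e , ≤-antisym (dist-≤ within-y) k≤dist-y
    where
      k≤dist-y : k ≤ dist y
      k≤dist-y = ≤-pred (subst (_≤ suc (dist y)) d≡1+k (dist-≤ (inj₂ (y , e , within-dist y))))

  parent : ∀ x → ∃ λ y → ∀ {k} → dist x ≡ suc k → Adj G x y × dist y ≡ k
  parent x with dist x in eq
  ... | zero  = x , λ ()
  ... | suc k with descend eq
  ...   | y , e , d = y , λ { refl → e , d }

  down : Fin n → Fin n
  down x = proj₁ (parent x)

  down-adj : ∀ {x k} → dist x ≡ suc k → Adj G x (down x)
  down-adj {x} d≡1+k = proj₁ (proj₂ (parent x) d≡1+k)

  down-dist : ∀ {x k} → dist x ≡ suc k → dist (down x) ≡ k
  down-dist {x} d≡1+k = proj₂ (proj₂ (parent x) d≡1+k)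

  iterate-down-S : ∀ k {x} → dist x ≡ k → S (iterate down x k)
  iterate-down-S zero    d≡0   = dist≡0⇒S d≡0
  iterate-down-S (suc k) d≡1+k = iterate-down-S k (down-dist d≡1+k)

module Alternating {n} (G : Graph n) (color : Fin n → Fin n → Parity)
                   (color-comm : ∀ x y → color x y ≡ color y x) where

  data AltWalk : Fin n → Fin n → Parity → Parity → Set where
    edge : ∀ {x y f} → Adj G x y → color x y ≡ f → AltWalk x y f f
    cons : ∀ {x y z f g l} → Adj G x y → color x y ≡ f → AltWalk y z g l → g ≡ f ⁻¹ → AltWalk x z f l

  join : ∀ {x y z f l g l′} → AltWalk x y f l → AltWalk y z g l′ → g ≡ l ⁻¹ → AltWalk x z f l′
  join (edge e c)       v g≡l⁻¹ = cons e c v g≡l⁻¹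
  join (cons e c w alt) v g≡l⁻¹ = cons e c (join w v g≡l⁻¹) alt

  reverse : ∀ {x y f l} → AltWalk x y f l → AltWalk y x l f
  reverse (edge {x} {y} e c) = edge (Adj-sym G e) (trans (color-comm y x) c)
  reverse (cons {x} {y} {f = f} e c w refl) =
    join (reverse w) (edge (Adj-sym G e) (trans (color-comm y x) c)) (sym (⁻¹-involutive f))

  cast : ∀ {x x′ y y′ f f′ l l′} → x ≡ x′ → y ≡ y′ → f ≡ f′ → l ≡ l′ →
         AltWalk x y f l → AltWalk x′ y′ f′ l′
  cast refl refl refl refl w = w

  coloring : EdgeColoring G 2
  coloring = record { col = λ x y → toFin2 (color x y) ; col-symm = λ x y → cong toFin2 (color-comm x y) }

  toWalk : ∀ {x y f l} → AltWalk x y f l → Walk G x y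
  toWalk (edge {x} {y} e _)  = cons x e [ y ]
  toWalk (cons {x} e _ w _) = cons x e (toWalk w)

  toFin2-alternates : ∀ {x y z f} → color x y ≡ f → color y z ≡ f ⁻¹ →
                      toFin2 (color x y) ≢ toFin2 (color y z)
  toFin2-alternates {f = f} c c′ eq = p≢p⁻¹ f (trans (sym c) (trans (toFin2-injective eq) c′))

  toWalk-proper : ∀ {x y f l} (w : AltWalk x y f l) → ProperlyColored coloring (toWalk w)
  toWalk-proper (edge _ _)                        = tt
  toWalk-proper (cons _ c (edge _ c′) refl)       = toFin2-alternates c c′ , tt
  toWalk-proper (cons _ c w@(cons _ c′ _ _) refl) = toFin2-alternates c c′ , toWalk-proper w

  AlternatesUpTo : ℕ → (ℕ → Fin n) → ℕ → Set
  AlternatesUpTo o s K = ∀ i → i < K → Adj G (s i) (s (suc i)) × color (s i) (s (suc i)) ≡ parity (i + o)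

  segment : ∀ {o s K a b} → AlternatesUpTo o s K → a ≤ b → b < K →
            AltWalk (s a) (s (suc b)) (parity (a + o)) (parity (b + o))
  segment {o} {s} {K} {a} alt a≤b = go (≤⇒≤′ a≤b)
    where
      go : ∀ {b} → a ≤′ b → b < K → AltWalk (s a) (s (suc b)) (parity (a + o)) (parity (b + o))
      go ≤′-refl b<K = edge (proj₁ (alt _ b<K)) (proj₂ (alt _ b<K))
      go (≤′-step {b} a≤′b) 1+b<K =
        join (go a≤′b (≤-trans (n≤1+n _) 1+b<K))
             (edge (proj₁ (alt _ 1+b<K)) (proj₂ (alt _ 1+b<K)))
             (parity-suc (b + o))

  module _ (h : Fin n) where

    Reaches : Fin n → Parity → Set
    Reaches x b = ∃ λ a → AltWalk x h b a

    Flexible : Fin n → Set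
    Flexible x = ∀ b → Reaches x b

    extend : ∀ {x y b a c} → AltWalk x y b a → Reaches y c → c ≡ a ⁻¹ → Reaches x b
    extend w (a′ , v) c≡a⁻¹ = a′ , join w v c≡a⁻¹

    pwColoring : (∀ p → AltWalk h h p p) → (∀ x → ∃ (Reaches x)) → PWColoring G coloring
    pwColoring loop reaches-hub u v with reaches-hub u | reaches-hub v
    ... | f , a , wu | g , b , wv = toWalk w , toWalk-proper w
      where
        w : AltWalk u v f g
        w with p≡q⊎p≡q⁻¹ b a
        ... | inj₁ refl = join wu (join (loop (a ⁻¹)) (reverse wv) (sym (⁻¹-involutive a))) refl
        ... | inj₂ refl = join wu (reverse wv) refl

  module OddCircuit {o M s} (alt : AlternatesUpTo o s (suc M)) (closed : s (suc M) ≡ s 0)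
                    (M-even : parity M ≡ 0ℙ) where

    forward : ∀ {i} → i ≤ M → AltWalk (s i) (s 0) (parity (i + o)) (parity o)
    forward i≤M = cast refl closed refl (parity[m+o]≡parity[o] M o M-even) (segment alt i≤M ≤-refl)

    backward : ∀ {j} → j < M → AltWalk (s (suc j)) (s 0) (parity (j + o)) (parity o)
    backward j<M = reverse (segment alt z≤n (m<n⇒m<1+n j<M))

    circuit : AltWalk (s 0) (s 0) (parity o) (parity o)
    circuit = forward z≤n

    toBase : ∀ {j} → j < M → ∀ b → AltWalk (s (suc j)) (s 0) b (parity o)
    toBase {j} j<M b with p≡q⊎p≡q⁻¹ b (parity (j + o))
    ... | inj₁ refl = backward j<M
    ... | inj₂ refl = cast refl refl (parity-suc (j + o)) refl (forward j<M)

    flexible : ∀ {h} → Flexible h (s 0) → ∀ {i} → i ≤ M → Flexible h (s i)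
    flexible g {zero}  _    = g
    flexible g {suc j} j<M b = extend _ (toBase j<M b) (g _) refl

module Construction {n} (G : Graph n) (conn : Connected G) (C D : Cycle G)
                    (C-odd : OddCycle C) (D-odd : OddCycle D) (disjoint : EdgeDisjoint C D) where

  module CW = CycleWalk C
  module DW = CycleWalk D

  open Distance G conn CW.onCycle? {vtx C zero} (zero , refl)

  opaque
    kD : Fin (suc (m D))
    kD = argmin (dist ∘ vtx D) zero (allFin _)

    kD-min : ∀ {x} → DW.OnCycle x → dist (vtx D kD) ≤ dist x
    kD-min (f , refl) = lookup (f[argmin]≤f[xs] {f = dist ∘ vtx D} zero (allFin _)) (∈-allFin f)

  d₀ : Fin n
  d₀ = vtx D kD

  L : ℕ
  L = dist d₀

  below-L⇒¬OnD : ∀ {x} → dist x < L → ¬ DW.OnCycle x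
  below-L⇒¬OnD d<L on = 1+n≰n (<-≤-trans d<L (kD-min on))

  c₀ : Fin n
  c₀ = iterate down d₀ L

  opaque
    c₀-on : CW.OnCycle c₀
    c₀-on = iterate-down-S L refl

  module RC = CW.Rotation (proj₁ c₀-on)
  module RD = DW.Rotation kD

  -- The offset suc L makes both edges of D at d₀ differ in color from the last edge of the path.
  colorOnD : Fin n → Fin n → Maybe Parity
  colorOnD x y = if does (DW.cycleEdge? x y) then RD.alternatingColor (suc L) x y else nothing

  color : Fin n → Fin n → Parity
  color x y = fromMaybe (parity (dist x ⊔ dist y)) (colorOnD x y <∣> RC.alternatingColor 0 x y)

  color-comm : ∀ x y → color x y ≡ color y x
  color-comm x y =
    cong₂ fromMaybe (cong parity (⊔-comm (dist x) (dist y)))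
                    (cong₂ _<∣>_ colorOnD-comm (RC.alternatingColor-comm 0 x y))
    where
      colorOnD-comm : colorOnD x y ≡ colorOnD y x
      colorOnD-comm = cong₂ (λ b c → if b then c else nothing)
                         (does-⇔ (mk⇔ DW.CycleEdge-comm DW.CycleEdge-comm) (DW.cycleEdge? x y) (DW.cycleEdge? y x))
                         (RD.alternatingColor-comm (suc L) x y)

  open Alternating G color color-comm

  color-D : ∀ {i} → i < suc (m D) → color (RD.s i) (RD.s (suc i)) ≡ parity (i + suc L)
  color-D {i} i<N rewrite dec-true (DW.cycleEdge? (RD.s i) (RD.s (suc i))) (RD.s-edge i)
                         | RD.alternatingColor-step (Odd[1+k]⇒parity[k]≡0ℙ D-odd) (suc L) i<N = refl

  color-C : ∀ {i} → i < suc (m C) → color (RC.s i) (RC.s (suc i)) ≡ parity (i + 0)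
  color-C {i} i<N rewrite dec-false (DW.cycleEdge? (RC.s i) (RC.s (suc i))) (disjoint _ _ (RC.s-edge i))
                         | RC.alternatingColor-step (Odd[1+k]⇒parity[k]≡0ℙ C-odd) 0 i<N = refl

  color-tree : ∀ {x y} → ¬ CycleEdge D x y → ¬ CW.OnCycle x → color x y ≡ parity (dist x ⊔ dist y)
  color-tree {x} {y} ¬e ¬on rewrite dec-false (DW.cycleEdge? x y) ¬e | RC.alternatingColor-nothing 0 y ¬on = refl

  color-down : ∀ {x k} → dist x ≡ suc k → ¬ CycleEdge D x (down x) → color x (down x) ≡ parity (suc k)
  color-down {x} {k} d≡1+k ¬e =
    trans (color-tree ¬e (λ on → 0≢1+n (trans (sym (S⇒dist≡0 on)) d≡1+k)))
          (cong parity (trans (cong₂ _⊔_ d≡1+k (down-dist d≡1+k)) (m≥n⇒m⊔n≡m (n≤1+n k))))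

  down-off-D : ∀ {x k} → dist x ≡ suc k → suc k ≤ L → ¬ CycleEdge D x (down x)
  down-off-D d≡1+k 1+k≤L e =
    below-L⇒¬OnD (subst (_< L) (sym (down-dist d≡1+k)) 1+k≤L) (proj₂ (DW.CycleEdge⇒OnCycle e))

  down-path : ∀ {k x} → dist x ≡ suc k → suc k ≤ L →
              AltWalk x (iterate down x (suc k)) (parity (suc k)) 1ℙ
  down-path {zero}  d≡1   1≤L   = edge (down-adj d≡1) (color-down d≡1 (down-off-D d≡1 1≤L))
  down-path {suc k} d≡2+k 2+k≤L =
    cons (down-adj d≡2+k) (color-down d≡2+k (down-off-D d≡2+k 2+k≤L))
         (down-path (down-dist d≡2+k) (≤-trans (n≤1+n _) 2+k≤L)) (parity-suc k)

  path : ∀ {k} → L ≡ suc k → AltWalk d₀ c₀ (parity L) 1ℙ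
  path L≡1+k = cast refl (cong (iterate down d₀) (sym L≡1+k)) (cong parity (sym L≡1+k)) refl
                    (down-path L≡1+k (≤-reflexive (sym L≡1+k)))

  d₀≡c₀ : L ≡ 0 → d₀ ≡ c₀
  d₀≡c₀ L≡0 = cong (iterate down d₀) (sym L≡0)

  module CC = OddCircuit {s = RC.s} (λ i i<N → CW.CycleEdge⇒Adj (RC.s-edge i) , color-C i<N)
                        RC.s-N (Odd[1+k]⇒parity[k]≡0ℙ C-odd)
  module DC = OddCircuit {s = RD.s} (λ i i<N → DW.CycleEdge⇒Adj (RD.s-edge i) , color-D i<N)
                        RD.s-N (Odd[1+k]⇒parity[k]≡0ℙ D-odd)

  c₀-base : RC.s 0 ≡ c₀
  c₀-base = trans RC.s-0 (proj₂ c₀-on)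

  D-circuit : AltWalk d₀ d₀ (parity (suc L)) (parity (suc L))
  D-circuit = cast RD.s-0 RD.s-0 refl refl DC.circuit

  -- The odd cycle D, entered and left through the path, switches the color at c₀.
  loop : ∀ p → AltWalk c₀ c₀ p p
  loop 0ℙ = cast c₀-base c₀-base refl refl CC.circuit
  loop 1ℙ = loop₁ refl
    where
      loop₁ : ∀ {l} → L ≡ l → AltWalk c₀ c₀ 1ℙ 1ℙ
      loop₁ {zero}  L≡0   = cast (d₀≡c₀ L≡0) (d₀≡c₀ L≡0) 1+L-odd 1+L-odd D-circuit
        where 1+L-odd = cong (parity ∘ suc) L≡0
      loop₁ {suc _} L≡1+k =
        join (reverse (path L≡1+k)) (join D-circuit (path L≡1+k) (sym (suc-homo-⁻¹ L))) (parity-suc L)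

  c₀-flexible : Flexible c₀ c₀
  c₀-flexible p = p , loop p

  d₀-flexible : Flexible c₀ d₀
  d₀-flexible = go refl
    where
      go : ∀ {l} → L ≡ l → Flexible c₀ d₀
      go {zero}  L≡0   = subst (Flexible c₀) (sym (d₀≡c₀ L≡0)) c₀-flexible
      go {suc _} L≡1+k b with p≡q⊎p≡q⁻¹ b (parity L)
      ... | inj₁ refl = 1ℙ , path L≡1+k
      ... | inj₂ refl =
        extend c₀ (cast refl refl (parity-suc L) refl D-circuit) (1ℙ , path L≡1+k) (sym (suc-homo-⁻¹ L))

  OnC⇒flexible : ∀ {x} → CW.OnCycle x → Flexible c₀ x
  OnC⇒flexible on with RC.OnCycle⇒position on
  ... | i , pos≡i with RC.position-just pos≡i
  ...   | i<N , refl = CC.flexible (subst (Flexible c₀) (sym c₀-base) c₀-flexible) (≤-pred i<N)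

  OnD⇒flexible : ∀ {x} → DW.OnCycle x → Flexible c₀ x
  OnD⇒flexible on with RD.OnCycle⇒position on
  ... | i , pos≡i with RD.position-just pos≡i
  ...   | i<N , refl = DC.flexible (subst (Flexible c₀) (sym RD.s-0) d₀-flexible) (≤-pred i<N)

  reaches-via-tree : ∀ k {x} → dist x ≡ k → ¬ CW.OnCycle x → ¬ DW.OnCycle x → Reaches c₀ x (parity k)
  reaches-via-tree zero    d≡0   ¬onC ¬onD = ⊥-elim (¬onC (dist≡0⇒S d≡0))
  reaches-via-tree (suc k) {x} d≡1+k ¬onC ¬onD =
    extend c₀ (edge (down-adj d≡1+k) (color-down d≡1+k (¬onD ∘ proj₁ ∘ DW.CycleEdge⇒OnCycle)))
              rest (sym (suc-homo-⁻¹ k))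
    where
      rest : Reaches c₀ (down x) (parity k)
      rest with CW.onCycle? (down x) | DW.onCycle? (down x)
      ... | yes onC  | _        = OnC⇒flexible onC (parity k)
      ... | no _     | yes onD  = OnD⇒flexible onD (parity k)
      ... | no ¬onC′ | no ¬onD′ = reaches-via-tree k (down-dist d≡1+k) ¬onC′ ¬onD′

  reaches-hub : ∀ x → ∃ (Reaches c₀ x)
  reaches-hub x with CW.onCycle? x | DW.onCycle? x
  ... | yes onC | _       = 0ℙ , OnC⇒flexible onC 0ℙ
  ... | no _    | yes onD = 0ℙ , OnD⇒flexible onD 0ℙ
  ... | no ¬onC | no ¬onD = parity (dist x) , reaches-via-tree (dist x) refl ¬onC ¬onD

  two-coloring : Σ (EdgeColoring G 2) (PWColoring G)
  two-coloring = coloring , pwColoring c₀ loop reaches-hub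

fin1-unique : (i j : Fin 1) → i ≡ j
fin1-unique zero zero = refl

no-PWColoring<2 : ∀ {n} (G : Graph n) → NonComplete G →
                  ∀ j → suc j ≤ 2 → ¬ Σ (EdgeColoring G j) (PWColoring G)
no-PWColoring<2 G (u , v , u≢v , nonadj) zero _ (c , _) with col c u u
... | ()
no-PWColoring<2 G (u , v , u≢v , nonadj) (suc zero) _ (c , pw) with pw u v
... | [ _ ] , _                             = u≢v refl
... | cons _ e [ _ ] , _ with trans (sym e) nonadj
...   | ()
no-PWColoring<2 G (u , v , u≢v , nonadj) (suc zero) _ (c , pw)
    | cons _ _ (cons _ _ _) , (colors-differ , _) = colors-differ (fin1-unique _ _)
no-PWColoring<2 G _ (suc (suc _)) (s≤s (s≤s ()))

mainTheorem4 : ∀ {n : ℕ} (G : Graph n) → Connected G → NonComplete G → (Σ (Cycle G) λ C → Σ (Cycle G) λ D → OddCycle C × OddCycle D × EdgeDisjoint C D) → pW≡ G 2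
mainTheorem4 G conn nc (C , D , C-odd , D-odd , disjoint) =
  Construction.two-coloring G conn C D C-odd D-odd disjoint , no-PWColoring<2 G nc
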